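{- Let $\Gamma$ be a finite simple undirected tree with vertices $v_1,\dots,v_N$ and adjacency matrix $A(\Gamma)$, and for vertices $a,b$ let $\gamma_{a,b}$ denote the unique path from $a$ to $b$ in $\Gamma$. Let $n\ge 3$ be an integer and suppose $\beta(A(\Gamma)^{n})_{i,j}-\beta(A(\Gamma)^{n-2})_{i,j}=1$. Then for every index $k$, $$\beta(A(\Gamma)^{n-1})_{i,k}-\beta(A(\Gamma)^{n-3})_{i,k}=1 \text{ and } A(\Gamma)_{j,k}=1 \iff \gamma_{v_i,v_j}=\gamma_{v_i,v_k}\cup(v_j),$$ where $\gamma_{v_i,v_k}\cup(v_j)$ denotes the sequence $\gamma_{v_i,v_k}$ with $v_j$ appended at the end.
   Context: For a square matrix $Q$, $\beta(Q)$ is the $(0,1)$-matrix with $\beta(Q)_{i,j}=1$ if $Q_{i,j}\ne 0$ and $0$ otherwise. $A(\Gamma)_{i,j}=1$ iff $\{v_i,v_j\}$ is an edge, else $0$; $A(\Gamma)^0$ is the identity matrix. A path is a sequence of distinct vertices with consecutive vertices adjacent; its length is its number of edges. -}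

module Defs where

open import Data.Nat using (ℕ; zero; suc; _+_; _*_; _≤_)
open import Data.Fin using (Fin; zero; suc; _≟_)
open import Data.Bool using (Bool; true; false; if_then_else_)
open import Data.List using (List; head; last; length)
open import Data.Maybe using (just)
open import Data.Product using (_×_; ∃)
open import Data.Empty using (⊥)
open import Relation.Nullary using (¬_; does)
open import Relation.Binary.PropositionalEquality using (_≡_)
open import Data.List.Relation.Unary.Unique.Propositional using (Unique)
open import Data.List.Relation.Unary.Linked using (Linked)

record SimpleGraph (N : ℕ) : Set where
  field
    adj   : Fin N → Fin N → Bool
    sym   : ∀ i j → adj i j ≡ adj j i
    irrfl : ∀ i → adj i i ≡ false

module _ {N : ℕ} (Γ : SimpleGraph N) where
  open SimpleGraph Γ

  Adj : Fin N → Fin N → Set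
  Adj i j = adj i j ≡ true

  IsPath : Fin N → Fin N → List (Fin N) → Set
  IsPath a b p = Unique p × Linked Adj p × head p ≡ just a × last p ≡ just b

  Connected : Set
  Connected = ∀ a b → ∃ λ p → IsPath a b p

  IsCycle : List (Fin N) → Set
  IsCycle c = ∃ λ x → ∃ λ y → IsPath x y c × 3 ≤ length c × Adj y x

  Acyclic : Set
  Acyclic = ∀ c → ¬ IsCycle c

  IsTree : Set
  IsTree = Connected × Acyclic

Mat : ℕ → Set
Mat N = Fin N → Fin N → ℕ

Σ[_] : ∀ {n} → (Fin n → ℕ) → ℕ
Σ[_] {zero}  f = 0
Σ[_] {suc n} f = f zero + Σ[ (λ i → f (suc i)) ]

_⊗_ : ∀ {N} → Mat N → Mat N → Mat N
(M ⊗ P) i j = Σ[ (λ k → M i k * P k j) ]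

I : ∀ {N} → Mat N
I i j = if does (i ≟ j) then 1 else 0

_^^_ : ∀ {N} → Mat N → ℕ → Mat N
M ^^ zero  = I
M ^^ suc n = M ⊗ (M ^^ n)

A : ∀ {N} → SimpleGraph N → Mat N
A Γ i j = if SimpleGraph.adj Γ i j then 1 else 0

β : ∀ {N} → Mat N → Mat N
β Q i j with Q i j
... | zero  = 0
... | suc _ = 1

module Submission where

-- β(A^m)_{ik} = 1 exactly when there is a walk of length m from v_i to v_k.  In a tree a walk
-- reduces, by cancelling backtracks, to the unique path with the same ends, so every walk from
-- v_i to v_k has length d(v_i,v_k) + 2t, and every such length occurs once v_i has a neighbour.
-- Thus the hypothesis says that γ_{v_i,v_j} has n edges, and the left-hand side says that
-- γ_{v_i,v_k} has n - 1 edges and v_k ~ v_j; by uniqueness of paths both mean γ_{v_i,v_j} = γ_{v_i,v_k} ∪ (v_j).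

open import Defs
open import Data.Nat using (ℕ; zero; suc; _+_; _*_; _∸_; _≤_; z≤n; s≤s)
open import Data.Nat.Properties
  using (m+n≡0⇒m≡0; m+n≡0⇒n≡0; m*n≡0⇒m≡0∨n≡0; *-zeroʳ; +-suc; m≤n+m; 1+n≰n; <⇒≤; suc-injective)
  renaming (_≟_ to _≟ℕ_)
open import Data.Fin using (Fin; zero; suc; _≟_)
open import Data.Integer using (+_; _-_)
open import Data.List using (List; []; _∷_; _∷ʳ_; [_]; length)
open import Data.List.Relation.Unary.Any using (here; there)
open import Data.List.Relation.Unary.All using ([])
open import Data.List.Relation.Unary.AllPairs using ([]; _∷_)
open import Data.List.Relation.Unary.All.Properties.Core using (¬Any⇒All¬; All¬⇒¬Any)
open import Data.List.Relation.Unary.Linked using ([-]; _∷_)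
open import Data.List.Relation.Binary.Subset.Propositional using (_⊆_)
open import Data.List.Relation.Binary.Subset.Propositional.Properties using (∷⁺ʳ)
open import Data.List.Membership.Propositional using (_∈_; _∉_)
open import Data.List.Membership.Propositional.Properties using (∈-++⁻)
import Data.List.Membership.DecPropositional as DecMembership
open import Data.Bool using (true; false)
open import Data.Product using (_×_; _,_; ∃; ∃₂; proj₂)
open import Data.Product.Function.NonDependent.Propositional using (_×-⇔_)
open import Data.Sum using (_⊎_; inj₁; inj₂)
open import Data.Empty using (⊥-elim)
open import Function using (_∘_)
open import Function.Bundles using (_⇔_; mk⇔; Equivalence)
open Equivalence using (to; from)
open import Function.Construct.Composition using (_⇔-∘_)
open import Function.Construct.Identity using (⇔-id)
open import Relation.Nullary using (¬_; yes; no; contradiction)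
open import Relation.Binary.PropositionalEquality using (_≡_; _≢_; refl; sym; trans; cong; cong₂; subst)

≢0⇒Σ≢0 : ∀ {n} (f : Fin n → ℕ) l → f l ≢ 0 → Σ[ f ] ≢ 0
≢0⇒Σ≢0 f zero    fl≢0 Σ≡0 = fl≢0 (m+n≡0⇒m≡0 (f zero) Σ≡0)
≢0⇒Σ≢0 f (suc l) fl≢0 Σ≡0 = ≢0⇒Σ≢0 (f ∘ suc) l fl≢0 (m+n≡0⇒n≡0 (f zero) Σ≡0)

Σ≢0⇒∃≢0 : ∀ {n} (f : Fin n → ℕ) → Σ[ f ] ≢ 0 → ∃ λ l → f l ≢ 0
Σ≢0⇒∃≢0 {zero}  f Σ≢0 = contradiction refl Σ≢0
Σ≢0⇒∃≢0 {suc n} f Σ≢0 with f zero ≟ℕ 0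
... | no  f0≢0 = zero , f0≢0
... | yes f0≡0 with Σ≢0⇒∃≢0 (f ∘ suc) (λ rest≡0 → Σ≢0 (cong₂ _+_ f0≡0 rest≡0))
...   | l , fl≢0 = suc l , fl≢0

I-diagonal : ∀ {N} (i : Fin N) → I i i ≡ 1
I-diagonal i with i ≟ i
... | yes _   = refl
... | no i≢i = contradiction refl i≢i

I≢0⇒≡ : ∀ {N} (i k : Fin N) → I i k ≢ 0 → i ≡ k
I≢0⇒≡ i k I≢0 with i ≟ k
... | yes i≡k = i≡k
... | no  _   = contradiction refl I≢0

β-difference≡1⇔ : ∀ {N} (Q R : Mat N) i k →
  ((+ β Q i k) - (+ β R i k) ≡ + 1) ⇔ (Q i k ≢ 0 × R i k ≡ 0)
β-difference≡1⇔ Q R i k with Q i k | R i k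
... | zero  | zero  = mk⇔ (λ ()) (λ (Q≢0 , _) → contradiction refl Q≢0)
... | zero  | suc _ = mk⇔ (λ ()) (λ ())
... | suc _ | zero  = mk⇔ (λ _ → (λ ()) , refl) (λ _ → refl)
... | suc _ | suc _ = mk⇔ (λ ()) (λ ())

module Walks {N : ℕ} (Γ : SimpleGraph N) where
  open SimpleGraph Γ using (adj; irrfl)

  Adj-sym : ∀ {a b} → Adj Γ a b → Adj Γ b a
  Adj-sym {a} {b} = trans (SimpleGraph.sym Γ b a)

  Adj-irrefl : ∀ {a} → ¬ Adj Γ a a
  Adj-irrefl {a} aa with trans (sym aa) (irrfl a)
  ... | ()

  A≡1⇔Adj : ∀ {a b} → A Γ a b ≡ 1 ⇔ Adj Γ a b
  A≡1⇔Adj {a} {b} with adj a b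
  ... | true  = mk⇔ (λ _ → refl) (λ _ → refl)
  ... | false = mk⇔ (λ ()) (λ ())

  A≢0⇒Adj : ∀ {a b} → A Γ a b ≢ 0 → Adj Γ a b
  A≢0⇒Adj {a} {b} A≢0 with adj a b
  ... | true  = refl
  ... | false = contradiction refl A≢0

  infixr 5 _◅_

  data Walk : ℕ → Fin N → Fin N → Set where
    ε   : ∀ {a} → Walk 0 a a
    _◅_ : ∀ {m a b c} → Adj Γ a b → Walk m b c → Walk (suc m) a c

  data Path : ℕ → Fin N → Fin N → List (Fin N) → Set where
    stop : ∀ {a} → Path 0 a a [ a ]
    step : ∀ {d a b c xs} → Adj Γ a b → a ∉ xs → Path d b c xs → Path (suc d) a c (a ∷ xs)

  Path⇒IsPath : ∀ {d a b p} → Path d a b p → IsPath Γ a b p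
  Path⇒IsPath stop = ([] ∷ []) , [-] , refl , refl
  Path⇒IsPath (step ab a∉xs stop) = (¬Any⇒All¬ _ a∉xs ∷ [] ∷ []) , (ab ∷ [-]) , refl , refl
  Path⇒IsPath (step ab a∉xs rest@(step _ _ _)) with Path⇒IsPath rest
  ... | unique , linked , _ , last≡b =
    (¬Any⇒All¬ _ a∉xs ∷ unique) , (ab ∷ linked) , refl , last≡b

  IsPath⇒Path : ∀ {a b} p → IsPath Γ a b p → ∃ λ d → Path d a b p
  IsPath⇒Path []           (_ , _ , () , _)
  IsPath⇒Path (x ∷ [])     (_ , _ , refl , refl) = 0 , stop
  IsPath⇒Path (x ∷ y ∷ ys) (x∉ ∷ unique , xy ∷ linked , refl , last≡b)
    with IsPath⇒Path (y ∷ ys) (unique , linked , refl , last≡b)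
  ... | d , rest = suc d , step xy (All¬⇒¬Any x∉) rest

  path⇒walk : ∀ {d a b p} → Path d a b p → Walk d a b
  path⇒walk stop            = ε
  path⇒walk (step ab _ rest) = ab ◅ path⇒walk rest

  walk-pad : ∀ {m a x b} → Adj Γ a x → Walk m a b → ∀ t → Walk (t * 2 + m) a b
  walk-pad ax w zero    = w
  walk-pad ax w (suc t) = ax ◅ Adj-sym ax ◅ walk-pad ax w t

  path-∷ʳ : ∀ {d a k j q} → Path d a k q → Adj Γ k j → j ∉ q → Path (suc d) a j (q ∷ʳ j)
  path-∷ʳ stop             kj j∉ = step kj (λ { (here refl) → j∉ (here refl) }) stop
  path-∷ʳ {j = j} (step {a = a} {xs = xs} ab a∉ rest) kj j∉ =
    step ab a∉xs∷ʳj (path-∷ʳ rest kj (j∉ ∘ there))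
    where
    a∉xs∷ʳj : a ∉ xs ∷ʳ j
    a∉xs∷ʳj a∈ with ∈-++⁻ xs a∈
    ... | inj₁ a∈xs         = a∉ a∈xs
    ... | inj₂ (here refl)  = j∉ (here refl)

  path-∷ʳ⁻ : ∀ {d e a a′ k c j q} → Path d a k q → Path e a′ c (q ∷ʳ j) → e ≡ suc d × Adj Γ k j
  path-∷ʳ⁻ stop            (step kj _ stop)  = refl , kj
  path-∷ʳ⁻ (step _ _ rest@stop)         (step _ _ rest′) with path-∷ʳ⁻ rest rest′
  ... | refl , kj = refl , kj
  path-∷ʳ⁻ (step _ _ rest@(step _ _ _)) (step _ _ rest′) with path-∷ʳ⁻ rest rest′
  ... | refl , kj = refl , kj

  path-prefix : ∀ {d a b x p} → Path d a b p → x ∈ p →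
    ∃₂ λ d′ q → Path d′ a x q × d′ ≤ d × q ⊆ p
  path-prefix stop             (here refl) = 0 , _ , stop , z≤n , λ x∈ → x∈
  path-prefix (step _ _ _)     (here refl) = 0 , _ , stop , z≤n , λ { (here refl) → here refl }
  path-prefix (step ab a∉ rest) (there x∈) with path-prefix rest x∈
  ... | d′ , q , prefix , d′≤d , q⊆ = suc d′ , _ , step ab (a∉ ∘ q⊆) prefix , s≤s d′≤d , ∷⁺ʳ _ q⊆

  walk⇒power≢0 : ∀ {m i k} → Walk m i k → (A Γ ^^ m) i k ≢ 0
  walk⇒power≢0 {i = i} ε I≡0 = contradiction (trans (sym (I-diagonal i)) I≡0) λ ()
  walk⇒power≢0 {suc m} {i} {k} (_◅_ {b = b} ib w) =
    ≢0⇒Σ≢0 (λ l → A Γ i l * (A Γ ^^ m) l k) b term≢0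
    where
    term≢0 : A Γ i b * (A Γ ^^ m) b k ≢ 0
    term≢0 term≡0 with m*n≡0⇒m≡0∨n≡0 (A Γ i b) term≡0
    ... | inj₁ A≡0 = contradiction (trans (sym (from A≡1⇔Adj ib)) A≡0) λ ()
    ... | inj₂ M≡0 = walk⇒power≢0 w M≡0

  power≢0⇒walk : ∀ {m i k} → (A Γ ^^ m) i k ≢ 0 → Walk m i k
  power≢0⇒walk {zero} {i} {k} I≢0 with I≢0⇒≡ i k I≢0
  ... | refl = ε
  power≢0⇒walk {suc m} {i} {k} Σ≢0 with Σ≢0⇒∃≢0 (λ l → A Γ i l * (A Γ ^^ m) l k) Σ≢0
  ... | l , term≢0 =
    A≢0⇒Adj (λ A≡0 → term≢0 (cong (_* _) A≡0))
      ◅ power≢0⇒walk (λ M≡0 → term≢0 (trans (cong (A Γ i l *_) M≡0) (*-zeroʳ (A Γ i l))))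

  β-power-difference≡1⇔ : ∀ {l l′ i k} →
    ((+ β (A Γ ^^ l) i k) - (+ β (A Γ ^^ l′) i k) ≡ + 1) ⇔ (Walk l i k × ¬ Walk l′ i k)
  β-power-difference≡1⇔ {l} {l′} {i} {k} =
    (mk⇔ power≢0⇒walk walk⇒power≢0 ×-⇔ mk⇔ (λ M≡0 w → walk⇒power≢0 w M≡0) ¬walk⇒power≡0)
      ⇔-∘ β-difference≡1⇔ (A Γ ^^ l) (A Γ ^^ l′) i k
    where
    ¬walk⇒power≡0 : ¬ Walk l′ i k → (A Γ ^^ l′) i k ≡ 0
    ¬walk⇒power≡0 ¬w with (A Γ ^^ l′) i k ≟ℕ 0
    ... | yes M≡0 = M≡0
    ... | no  M≢0 = contradiction (power≢0⇒walk M≢0) ¬w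

  closed-path-isCycle : ∀ {d a x c} → Path (suc (suc d)) a x c → Adj Γ x a → IsCycle Γ c
  closed-path-isCycle path xa = _ , _ , Path⇒IsPath path , three-vertices path , xa
    where
    three-vertices : ∀ {d a x c} → Path (suc (suc d)) a x c → 3 ≤ length c
    three-vertices (step _ _ (step _ _ stop))         = s≤s (s≤s (s≤s z≤n))
    three-vertices (step _ _ (step _ _ (step _ _ _))) = s≤s (s≤s (s≤s z≤n))

  target∈path : ∀ {d a b p} → Path d a b p → b ∈ p
  target∈path stop            = here refl
  target∈path (step _ _ rest) = there (target∈path rest)

module Acyclic {N : ℕ} (Γ : SimpleGraph N) (acyclic : Acyclic Γ) where
  open Walks Γ
  open DecMembership (_≟_ {N}) using (_∈?_)

  -- Any other position of x on the path would close a cycle through the edge x a.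
  path-from-neighbour : ∀ {d x a k p} → Adj Γ x a → Path d a k p →
    x ∉ p ⊎ ∃₂ λ d′ q → d ≡ suc d′ × p ≡ a ∷ q × Path d′ x k q
  path-from-neighbour {x = x} {p = p} xa path with x ∈? p
  ... | no x∉p = inj₁ x∉p
  path-from-neighbour xa stop            | yes (here refl) = ⊥-elim (Adj-irrefl xa)
  path-from-neighbour xa (step _ _ _)    | yes (here refl) = ⊥-elim (Adj-irrefl xa)
  path-from-neighbour xa (step _ _ rest@stop)         | yes (there (here refl)) =
    inj₂ (_ , _ , refl , refl , rest)
  path-from-neighbour xa (step _ _ rest@(step _ _ _)) | yes (there (here refl)) =
    inj₂ (_ , _ , refl , refl , rest)
  path-from-neighbour xa (step ab a∉ (step bc b∉ rest)) | yes (there (there x∈))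
    with path-prefix rest x∈
  ... | _ , _ , prefix , _ , q⊆ =
    ⊥-elim (acyclic _ (closed-path-isCycle (step ab (a∉ ∘ ∷⁺ʳ _ q⊆) (step bc (b∉ ∘ q⊆) prefix)) xa))

  path-unique : ∀ {d d′ a b p q} → Path d a b p → Path d′ a b q → d ≡ d′ × p ≡ q
  path-unique stop              stop              = refl , refl
  path-unique stop              (step _ a∉ rest)  = ⊥-elim (a∉ (target∈path rest))
  path-unique (step _ a∉ rest)  stop              = ⊥-elim (a∉ (target∈path rest))
  path-unique (step ab a∉ rest) path@(step _ _ _) with path-from-neighbour (Adj-sym ab) path
  ... | inj₁ b∉ with path-unique rest (step (Adj-sym ab) b∉ path)
  ...   | _ , refl = ⊥-elim (a∉ (there (here refl)))
  path-unique (step ab a∉ rest) path@(step _ _ _) | inj₂ (_ , _ , refl , refl , rest′)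
    with path-unique rest rest′
  ...   | refl , refl = refl , refl

  walk⇒path : ∀ {m a b} → Walk m a b → ∃₂ λ d p → Path d a b p × ∃ λ t → m ≡ t * 2 + d
  walk⇒path ε = 0 , _ , stop , 0 , refl
  walk⇒path (ab ◅ w) with walk⇒path w
  ... | d , p , path , t , refl with path-from-neighbour ab path
  ...   | inj₁ a∉p = suc d , _ , step ab a∉p path , t , sym (+-suc (t * 2) d)
  ...   | inj₂ (d′ , q , refl , refl , path′) = d′ , q , path′ , suc t , cong suc (+-suc (t * 2) d′)

  path≤walk : ∀ {d m a b p} → Path d a b p → Walk m a b → d ≤ m
  path≤walk {d} path w with walk⇒path w
  ... | _ , _ , path′ , t , refl with path-unique path path′
  ...   | refl , _ = m≤n+m d (t * 2)

  exact-walk⇔path : ∀ {d a b} → (Walk (2 + d) a b × ¬ Walk d a b) ⇔ ∃ (Path (2 + d) a b)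
  exact-walk⇔path {d} {a} {b} = mk⇔ exact⇒path path⇒exact
    where
    path⇒exact : ∃ (Path (2 + d) a b) → Walk (2 + d) a b × ¬ Walk d a b
    path⇒exact (_ , path) = path⇒walk path , λ w → 1+n≰n (<⇒≤ (path≤walk path w))
    -- If reducing the walk cancelled t + 1 backtracks, padding the path with only t of them gives length d.
    exact⇒path : Walk (2 + d) a b × ¬ Walk d a b → ∃ (Path (2 + d) a b)
    exact⇒path (w@(ax ◅ _) , ¬w) with walk⇒path w
    ... | _ , p , path , zero  , refl = p , path
    ... | _ , _ , path , suc t , 2+d≡ =
      contradiction (subst (λ m → Walk m a b) (sym (suc-injective (suc-injective 2+d≡)))
                           (walk-pad ax (path⇒walk path) t))
                    ¬w

  path-extension : Connected Γ → ∀ {d i j k P} → Path (suc d) i j P →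
    (∃ (Path d i k) × Adj Γ j k) ⇔ (∀ p q → IsPath Γ i j p → IsPath Γ i k q → p ≡ q ∷ʳ j)
  path-extension connected {d} {i} {j} {k} {P} i⇝j = mk⇔ extend restrict
    where
    extend : ∃ (Path d i k) × Adj Γ j k → ∀ p q → IsPath Γ i j p → IsPath Γ i k q → p ≡ q ∷ʳ j
    extend ((Q , i⇝k) , jk) p q p-path q-path =
      trans (proj₂ (path-unique (proj₂ (IsPath⇒Path p p-path)) (path-∷ʳ i⇝k (Adj-sym jk) j∉Q)))
            (cong (_∷ʳ j) (proj₂ (path-unique i⇝k (proj₂ (IsPath⇒Path q q-path)))))
      where
      -- A visit to j within d steps would give a second, shorter path from i to j.
      j∉Q : j ∉ Q
      j∉Q j∈Q with path-prefix i⇝k j∈Q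
      ... | _ , _ , i⇝j′ , d′≤d , _ with path-unique i⇝j i⇝j′
      ...   | refl , _ = 1+n≰n d′≤d
    restrict : (∀ p q → IsPath Γ i j p → IsPath Γ i k q → p ≡ q ∷ʳ j) → ∃ (Path d i k) × Adj Γ j k
    restrict P≡Q∷ʳj with connected i k
    ... | q , q-path with IsPath⇒Path q q-path
    ...   | d′ , i⇝k
      with path-∷ʳ⁻ i⇝k (subst (Path (suc d) i j) (P≡Q∷ʳj P q (Path⇒IsPath i⇝j) q-path) i⇝j)
    ...     | d≡d′ , kj = (q , subst (λ e → Path e i k q) (sym (suc-injective d≡d′)) i⇝k) , Adj-sym kj

corollary1p1 : {N : ℕ} (Γ : SimpleGraph N) → IsTree Γ →
    (n : ℕ) → 3 ≤ n → (i j : Fin N) →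
    (+ β (A Γ ^^ n) i j) - (+ β (A Γ ^^ (n ∸ 2)) i j) ≡ + 1 →
    (k : Fin N) →
      (((+ β (A Γ ^^ (n ∸ 1)) i k) - (+ β (A Γ ^^ (n ∸ 3)) i k) ≡ + 1) × A Γ j k ≡ 1)
      ⇔ (∀ (p q : List (Fin N)) → IsPath Γ i j p → IsPath Γ i k q → p ≡ q ∷ʳ j)
corollary1p1 Γ (connected , acyclic) .(3 + m) (s≤s (s≤s (s≤s {n = m} _))) i j β-ij≡1 k =
  path-extension connected i⇝j
    ⇔-∘ ((exact-walk⇔path ×-⇔ ⇔-id _) ⇔-∘ (β-power-difference≡1⇔ ×-⇔ A≡1⇔Adj))
  where
  open Walks Γ
  open Acyclic Γ acyclic
  i⇝j : Path (3 + m) i j _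
  i⇝j = proj₂ (to exact-walk⇔path (to β-power-difference≡1⇔ β-ij≡1))
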